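{- Let $k,p$ be nonnegative integers with $k\le 3$. Then the complete split graph $S_{k,p}$ is $K$-non-trivial, where $K$ is the clique (of size $k$) of $S_{k,p}$.
   Context: All graphs are finite, simple and undirected. $S_{k,p}$ is the graph obtained from a clique $K$ on $k$ vertices and a disjoint independent set on $p$ vertices by adding all edges between them. $H$ is an induced minor of $G$ if $H$ can be obtained from $G$ by deleting vertices and contracting edges. An induced minor model of $H$ in $G$ is a collection $\{X_w : w\in V(H)\}$ of pairwise disjoint non-empty subsets of $V(G)$ such that each $G[X_w]$ is connected, and for distinct $w,w'$, $X_w$ and $X_{w'}$ are joined by an edge of $G$ if and only if $ww'\in E(H)$. For $S\subseteq V(H)$, $H$ is $S$-non-trivial if for every graph $G$ having $H$ as an induced minor, there exists a model $\{X_w\}$ of $H$ in $G$ with $|X_w|=1$ for every $w\in V(H)\setminus S$. -}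

module Defs where

open import Data.Nat using (ℕ; _<_; _≤_; _<ᵇ_; _+_)
open import Data.Bool using (Bool; true; false; _∧_; _∨_; not)
open import Data.Bool.Properties using (∨-comm)
open import Data.Fin using (Fin; toℕ; _≟_)
open import Data.Fin.Subset using (Subset; _∈_; _∉_; ∣_∣; Nonempty)
open import Data.Product using (Σ; ∃; _×_; _,_)
open import Relation.Nullary using (¬_; yes; no)
open import Relation.Nullary.Decidable using (⌊_⌋)
open import Relation.Binary.PropositionalEquality using (_≡_; refl; sym)
open import Function.Bundles using (_⇔_)

record Graph : Set where
  field
    n      : ℕ
    adj    : Fin n → Fin n → Bool
    adj-sym    : ∀ i j → adj i j ≡ adj j i
    adj-irrefl : ∀ i → adj i i ≡ false
open Graph public

V : Graph → Set
V G = Fin (n G)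

Edge : (G : Graph) → V G → V G → Set
Edge G i j = adj G i j ≡ true

data WalkIn (G : Graph) (X : Subset (n G)) : V G → V G → Set where
  stay : ∀ {x} → x ∈ X → WalkIn G X x x
  step : ∀ {x y z} → x ∈ X → Edge G x y → WalkIn G X y z → WalkIn G X x z

-- G[X] is connected (X non-empty is required separately).
Connected : (G : Graph) → Subset (n G) → Set
Connected G X = ∀ x y → x ∈ X → y ∈ X → WalkIn G X x y

Joined : (G : Graph) → Subset (n G) → Subset (n G) → Set
Joined G X Y = Σ (V G) λ x → Σ (V G) λ y → x ∈ X × y ∈ Y × Edge G x y

record Model (H G : Graph) : Set where
  field
    X          : V H → Subset (n G)
    nonempty   : ∀ w → Nonempty (X w)
    connected  : ∀ w → Connected G (X w)
    disjoint   : ∀ w w' → ¬ (w ≡ w') → ∀ x → x ∈ X w → x ∉ X w'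
    edges      : ∀ w w' → ¬ (w ≡ w') → (Joined G (X w) (X w') ⇔ Edge H w w')
open Model public

IsInducedMinor : Graph → Graph → Set
IsInducedMinor H G = Model H G

NonTrivial : (H : Graph) → (V H → Set) → Set
NonTrivial H S = ∀ (G : Graph) → IsInducedMinor H G →
  Σ (Model H G) λ M → ∀ w → ¬ S w → ∣ X M w ∣ ≡ 1

-- The complete split graph S_{k,p}: vertices Fin (k + p); those with index < k
-- form the clique K, the remaining p form an independent set, all edges between.
S-adj : (k p : ℕ) → Fin (k + p) → Fin (k + p) → Bool
S-adj k p i j = not ⌊ i ≟ j ⌋ ∧ ((toℕ i <ᵇ k) ∨ (toℕ j <ᵇ k))

private
  ≟-sym : ∀ {m} (i j : Fin m) → ⌊ i ≟ j ⌋ ≡ ⌊ j ≟ i ⌋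
  ≟-sym i j with i ≟ j | j ≟ i
  ... | yes _ | yes _ = refl
  ... | no _  | no _  = refl
  ... | yes e | no ne with ne (sym e)
  ... | ()
  ≟-sym i j | no ne | yes e with ne (sym e)
  ... | ()

  ≟-refl : ∀ {m} (i : Fin m) → ⌊ i ≟ i ⌋ ≡ true
  ≟-refl i with i ≟ i
  ... | yes _ = refl
  ... | no ne with ne refl
  ... | ()

S-sym : ∀ k p i j → S-adj k p i j ≡ S-adj k p j i
S-sym k p i j rewrite ≟-sym i j | ∨-comm (toℕ i <ᵇ k) (toℕ j <ᵇ k) = refl

S-irrefl : ∀ k p i → S-adj k p i i ≡ false
S-irrefl k p i rewrite ≟-refl i = refl

SplitGraph : ℕ → ℕ → Graph
SplitGraph k p = record
  { n = k + p ; adj = S-adj k p ; adj-sym = S-sym k p ; adj-irrefl = S-irrefl k p }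

Clique : (k p : ℕ) → V (SplitGraph k p) → Set
Clique k p w = toℕ w < k

-- Descend along models of S_{k,p} in G, decreasing the number of vertices of G lying in
-- parts X_w with w outside the clique K.  If such an X_w has two vertices, the ends of two
-- maximal paths in G[X_w] give non-cut vertices u₁ ≠ u₂.  Every clique part X_c touches X_w,
-- hence touches X_w - u₁ or X_w - u₂; since |K| ≤ 3, for one of them, u, the set X_w - u
-- touches all clique parts but at most one, c₀.  All neighbours of w lie in K, so either
-- deleting u from X_w, or moving u into X_c₀ (c₀ is adjacent to everything and u touches
-- X_c₀), is again a model, with one vertex fewer outside the clique parts.
module Submission where

open import Data.Bool using (true; false)
import Data.Bool as Bool
open import Data.Bool.Properties using (T-≡; T-∧; T-∨)
open import Data.Empty using (⊥-elim)
open import Data.Fin using (Fin; _≟_; toℕ; fromℕ<)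
open import Data.Fin.Properties using (any?; toℕ-injective; fromℕ<-injective; injective⇒≤)
open import Data.Fin.Subset using (Subset; _∈_; _∉_; _⊆_; _∪_; _─_; _-_; ⁅_⁆; ∁; ∣_∣; Nonempty)
open import Data.Fin.Subset.Properties
  using (_∈?_; x∈⁅x⁆; x∈⁅y⁆⇒x≡y; ∣⁅x⁆∣≡1; ⊆-antisym; p─q⊆p; x∈p∧x≢y⇒x∈p-y; p⊆p∪q; q⊆p∪q; x∈p∪q⁻;
         p⊂q⇒∣p∣<∣q∣; p⊂q⇒∁p⊃∁q)
open import Data.Nat as ℕ using (ℕ; suc; _<_; _≤_; _<?_)
open import Data.Nat.Induction using (<-wellFounded)
open import Data.Nat.Properties using (<-irrefl; ≤-trans; <⇒<ᵇ; <ᵇ⇒<)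
open import Data.Product using (∃; ∃₂; _×_; _,_; proj₁; proj₂)
open import Data.Sum using (_⊎_; inj₁; inj₂; [_,_]′)
open import Data.Unit using (⊤; tt)
open import Data.Vec using (Vec; tabulate; _∷_; []; here; there)
open import Data.Vec.Membership.Propositional.Properties using (∈-lookup)
open import Data.Vec.Properties using (lookup∘tabulate; []=⇒lookup; lookup⇒[]=)
open import Data.Vec.Relation.Unary.All as All using (All; _∷_; [])
open import Data.Vec.Relation.Unary.AllPairs using (_∷_; [])
open import Data.Vec.Relation.Unary.Unique.Propositional using (Unique)
open import Data.Vec.Relation.Unary.Unique.Propositional.Properties using (lookup-injective)
open import Function using (_∘_; id)
open import Function.Bundles using (Equivalence; mk⇔)
open import Function.Definitions using (Injective)
open import Induction.WellFounded using (Acc; acc)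
import Relation.Binary.Construct.On as On
open import Relation.Binary.Definitions using (DecidableEquality)
open import Relation.Binary.PropositionalEquality using (_≡_; _≢_; refl; sym; trans; subst; cong; ≢-sym)
open import Relation.Nullary using (¬_; Dec; yes; no; does; ¬?)
open import Relation.Nullary.Decidable
  using (fromWitnessFalse; dec-true; decidable-stable; _×-dec_; _⊎-dec_)
open import Relation.Unary using (Decidable)

open import Defs

descend : {A : Set} {P : A → Set} (μ : A → ℕ) → (∀ x → P x ⊎ ∃ λ y → μ y < μ x) → A → ∃ P
descend {P = P} μ progress x = go x (On.wellFounded μ <-wellFounded x)
  where
  go : ∀ x → Acc (λ y z → μ y < μ z) x → ∃ P
  go x (acc rs) with progress x
  ... | inj₁ px = x , px
  ... | inj₂ (y , μy<μx) = go y (rs μy<μx)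

module _ {n : ℕ} where

  toSubset : {P : Fin n → Set} → Decidable P → Subset n
  toSubset P? = tabulate (does ∘ P?)

  ∈-toSubset⁺ : {P : Fin n → Set} (P? : Decidable P) {x : Fin n} → P x → x ∈ toSubset P?
  ∈-toSubset⁺ P? {x} px = lookup⇒[]= x _ (trans (lookup∘tabulate _ x) (dec-true (P? x) px))

  ∈-toSubset⁻ : {P : Fin n → Set} (P? : Decidable P) {x : Fin n} → x ∈ toSubset P? → P x
  ∈-toSubset⁻ P? {x} x∈ with P? x | trans (sym (lookup∘tabulate (does ∘ P?) x)) ([]=⇒lookup x∈)
  ... | yes px | _ = px
  ... | no _   | ()

x∈p─q⇒x∉q : ∀ {n} (p q : Subset n) {x} → x ∈ p ─ q → x ∉ q
x∈p─q⇒x∉q (true ∷ p) (false ∷ q) here ()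
x∈p─q⇒x∉q (_ ∷ p) (_ ∷ q) (there x∈) (there x∈q) = x∈p─q⇒x∉q p q x∈ x∈q

module _ {n : ℕ} {p : Subset n} where

  x∈p-y⇒x≢y : ∀ {x y} → x ∈ p - y → x ≢ y
  x∈p-y⇒x≢y {y = y} x∈ refl = x∈p─q⇒x∉q p ⁅ y ⁆ x∈ (x∈⁅x⁆ y)

  x∈p-y⇒x∈p : ∀ {x y} → x ∈ p - y → x ∈ p
  x∈p-y⇒x∈p {y = y} = p─q⊆p p ⁅ y ⁆

  y∉p⇒p-y≡p : ∀ {y} → y ∉ p → p - y ≡ p
  y∉p⇒p-y≡p y∉p = ⊆-antisym x∈p-y⇒x∈p (λ x∈p → x∈p∧x≢y⇒x∈p-y x∈p λ { refl → y∉p x∈p })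

  x∈p⇒⁅x⁆⊆p : ∀ {x} → x ∈ p → ⁅ x ⁆ ⊆ p
  x∈p⇒⁅x⁆⊆p {x} x∈p y∈⁅x⁆ = subst (_∈ p) (sym (x∈⁅y⁆⇒x≡y x y∈⁅x⁆)) x∈p

  ∣p∣≢1⇒two-elements : Nonempty p → ∣ p ∣ ≢ 1 → ∃₂ λ x y → x ∈ p × y ∈ p × x ≢ y
  ∣p∣≢1⇒two-elements (x , x∈p) ∣p∣≢1 with any? (λ y → (y ∈? p) ×-dec ¬? (y ≟ x))
  ... | yes (y , y∈p , y≢x) = y , x , y∈p , x∈p , y≢x
  ... | no noOther = ⊥-elim (∣p∣≢1 (trans (cong ∣_∣ p≡⁅x⁆) (∣⁅x⁆∣≡1 x)))
    where
    p≡⁅x⁆ : p ≡ ⁅ x ⁆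
    p≡⁅x⁆ = ⊆-antisym
      (λ {y} y∈p → subst (_∈ ⁅ x ⁆) (sym (decidable-stable (y ≟ x) (λ y≢x → noOther (y , y∈p , y≢x))))
                                     (x∈⁅x⁆ x))
      (x∈p⇒⁅x⁆⊆p x∈p)

module GraphProperties (G : Graph) where

  Edge-sym : ∀ {x y} → Edge G x y → Edge G y x
  Edge-sym {x} {y} e = trans (adj-sym G y x) e

  Edge-irrefl : ∀ {x} → ¬ Edge G x x
  Edge-irrefl {x} e with trans (sym e) (adj-irrefl G x)
  ... | ()

  Edge? : ∀ x y → Dec (Edge G x y)
  Edge? x y = adj G x y Bool.≟ true

  walk-start : ∀ {X x y} → WalkIn G X x y → x ∈ X
  walk-start (stay x∈X) = x∈X
  walk-start (step x∈X _ _) = x∈X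

  walk-end : ∀ {X x y} → WalkIn G X x y → y ∈ X
  walk-end (stay y∈X) = y∈X
  walk-end (step _ _ w) = walk-end w

  _++ʷ_ : ∀ {X x y z} → WalkIn G X x y → WalkIn G X y z → WalkIn G X x z
  stay _ ++ʷ w' = w'
  step x∈X e w ++ʷ w' = step x∈X e (w ++ʷ w')

  reverse : ∀ {X x y} → WalkIn G X x y → WalkIn G X y x
  reverse (stay x∈X) = stay x∈X
  reverse (step x∈X e w) = reverse w ++ʷ step (walk-start w) (Edge-sym e) (stay x∈X)

  walk-mono : ∀ {X Y x y} → X ⊆ Y → WalkIn G X x y → WalkIn G Y x y
  walk-mono X⊆Y (stay x∈X) = stay (X⊆Y x∈X)
  walk-mono X⊆Y (step x∈X e w) = step (X⊆Y x∈X) e (walk-mono X⊆Y w)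

  split-at-first-visit : ∀ {X x u} → x ≢ u → WalkIn G X x u →
                         ∃ λ t → WalkIn G (X - u) x t × Edge G t u
  split-at-first-visit x≢u (stay _) = ⊥-elim (x≢u refl)
  split-at-first-visit {u = u} x≢u (step {y = y} x∈X e w) with y ≟ u
  ... | yes refl = _ , stay (x∈p∧x≢y⇒x∈p-y x∈X x≢u) , e
  ... | no y≢u with split-at-first-visit y≢u w
  ...   | t , w' , e' = t , step (x∈p∧x≢y⇒x∈p-y x∈X x≢u) e w' , e'

  hub⇒Connected : ∀ {X a} → (∀ x → x ∈ X → WalkIn G X x a) → Connected G X
  hub⇒Connected toHub x y x∈X y∈X = toHub x x∈X ++ʷ reverse (toHub y y∈X)

  Joined? : ∀ A B → Dec (Joined G A B)
  Joined? A B = any? λ x → any? λ y → (x ∈? A) ×-dec (y ∈? B) ×-dec Edge? x y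

  Joined-mono : ∀ {A A' B B'} → A ⊆ A' → B ⊆ B' → Joined G A B → Joined G A' B'
  Joined-mono A⊆A' B⊆B' (x , y , x∈A , y∈B , e) = x , y , A⊆A' x∈A , B⊆B' y∈B , e

  Joined-sym : ∀ {A B} → Joined G A B → Joined G B A
  Joined-sym (x , y , x∈A , y∈B , e) = y , x , y∈B , x∈A , Edge-sym e

  Joined-minus⊎Joined-⁅⁆ : ∀ {A B} u → Joined G A B → Joined G (A - u) B ⊎ Joined G ⁅ u ⁆ B
  Joined-minus⊎Joined-⁅⁆ u (x , y , x∈A , y∈B , e) with x ≟ u
  ... | yes refl = inj₂ (x , y , x∈⁅x⁆ x , y∈B , e)
  ... | no x≢u = inj₁ (x , y , x∈p∧x≢y⇒x∈p-y x∈A x≢u , y∈B , e)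

  Joined-minus-either : ∀ {A B u₁ u₂} → u₁ ∈ A → u₁ ≢ u₂ → Joined G A B →
                        Joined G (A - u₁) B ⊎ Joined G (A - u₂) B
  Joined-minus-either {u₁ = u₁} u₁∈A u₁≢u₂ j with Joined-minus⊎Joined-⁅⁆ u₁ j
  ... | inj₁ j₁ = inj₁ j₁
  ... | inj₂ j₁ = inj₂ (Joined-mono (x∈p⇒⁅x⁆⊆p (x∈p∧x≢y⇒x∈p-y u₁∈A u₁≢u₂)) id j₁)

  Connected⇒Joined-minus-⁅⁆ : ∀ {A u} → Connected G A → u ∈ A → Nonempty (A - u) →
                              Joined G (A - u) ⁅ u ⁆
  Connected⇒Joined-minus-⁅⁆ {A} {u} conA u∈A (a , a∈A-u)
    with split-at-first-visit (x∈p-y⇒x≢y a∈A-u) (conA a u (x∈p-y⇒x∈p a∈A-u) u∈A)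
  ... | t , w , e = t , u , walk-end w , x∈⁅x⁆ u , e

  Connected-∪⁅⁆ : ∀ {A u} → Connected G A → Joined G ⁅ u ⁆ A → Connected G (A ∪ ⁅ u ⁆)
  Connected-∪⁅⁆ {A} {u} conA (u' , z , u'∈⁅u⁆ , z∈A , e) = hub⇒Connected toZ
    where
    toZ : ∀ x → x ∈ A ∪ ⁅ u ⁆ → WalkIn G (A ∪ ⁅ u ⁆) x z
    toZ x x∈ with x∈p∪q⁻ A ⁅ u ⁆ x∈
    ... | inj₁ x∈A = walk-mono (p⊆p∪q ⁅ u ⁆) (conA x z x∈A z∈A)
    ... | inj₂ x∈⁅u⁆ rewrite x∈⁅y⁆⇒x≡y u x∈⁅u⁆ | x∈⁅y⁆⇒x≡y u u'∈⁅u⁆ =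
      step x∈ e (stay (p⊆p∪q ⁅ u ⁆ z∈A))

module NonCutVertex (G : Graph) {X : Subset (n G)} (conX : Connected G X) {a : V G} (a∈X : a ∈ X) where
  open GraphProperties G

  -- A path in G[X] from a to end; the vertices before end form visited and reach a within it.
  record Trail : Set where
    field
      visited     : Subset (n G)
      end         : V G
      visited⊆X   : visited ⊆ X
      end∈X       : end ∈ X
      end∉visited : end ∉ visited
      reach       : ∀ {z} → z ∈ visited → WalkIn G visited z a
      linked      : Joined G ⁅ end ⁆ visited

  open Trail

  a∈visited : (T : Trail) → a ∈ visited T
  a∈visited T with linked T
  ... | _ , t , _ , t∈visited , _ = walk-end (reach T t∈visited)

  Maximal : Trail → Set
  Maximal T = ∀ {y} → y ∈ X → Edge G (end T) y → y ∈ visited T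

  extend : (T : Trail) {y : V G} → y ∈ X → Edge G (end T) y → y ∉ visited T → Trail
  extend T {y} y∈X e y∉visited = record
    { visited     = visited'
    ; end         = y
    ; end∈X       = y∈X
    ; visited⊆X   = visited'⊆X
    ; end∉visited = y∉visited'
    ; reach       = reach'
    ; linked      = y , end T , x∈⁅x⁆ y , end∈visited' , Edge-sym e
    }
    where
    visited' : Subset (n G)
    visited' = visited T ∪ ⁅ end T ⁆
    old⊆new : visited T ⊆ visited'
    old⊆new = p⊆p∪q ⁅ end T ⁆
    end∈visited' : end T ∈ visited'
    end∈visited' = q⊆p∪q (visited T) ⁅ end T ⁆ (x∈⁅x⁆ (end T))
    visited'⊆X : visited' ⊆ X
    visited'⊆X z∈ = [ visited⊆X T , x∈p⇒⁅x⁆⊆p (end∈X T) ]′ (x∈p∪q⁻ (visited T) ⁅ end T ⁆ z∈)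
    y∉visited' : y ∉ visited'
    y∉visited' y∈ with x∈p∪q⁻ (visited T) ⁅ end T ⁆ y∈
    ... | inj₁ y∈visited = y∉visited y∈visited
    ... | inj₂ y∈⁅end⁆ = Edge-irrefl (subst (Edge G (end T)) (x∈⁅y⁆⇒x≡y (end T) y∈⁅end⁆) e)
    reach' : ∀ {z} → z ∈ visited' → WalkIn G visited' z a
    reach' z∈ with x∈p∪q⁻ (visited T) ⁅ end T ⁆ z∈ | linked T
    ... | inj₁ z∈visited | _ = walk-mono old⊆new (reach T z∈visited)
    ... | inj₂ z∈⁅end⁆ | e′ , t , e′∈⁅end⁆ , t∈visited , et
      rewrite x∈⁅y⁆⇒x≡y (end T) z∈⁅end⁆ | x∈⁅y⁆⇒x≡y (end T) e′∈⁅end⁆ =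
      step z∈ et (walk-mono old⊆new (reach T t∈visited))

  extend-grows : (T : Trail) {y : V G} (y∈X : y ∈ X) (e : Edge G (end T) y) (y∉ : y ∉ visited T) →
                 ∣ ∁ (visited (extend T y∈X e y∉)) ∣ < ∣ ∁ (visited T) ∣
  extend-grows T y∈X e y∉ = p⊂q⇒∣p∣<∣q∣ (p⊂q⇒∁p⊃∁q
    (p⊆p∪q ⁅ end T ⁆ , end T , q⊆p∪q (visited T) ⁅ end T ⁆ (x∈⁅x⁆ (end T)) , end∉visited T))

  maximal-or-extend : (T : Trail) → Maximal T ⊎ ∃ λ T' → ∣ ∁ (visited T') ∣ < ∣ ∁ (visited T) ∣
  maximal-or-extend T with any? (λ y → (y ∈? X) ×-dec Edge? (end T) y ×-dec ¬? (y ∈? visited T))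
  ... | yes (y , y∈X , e , y∉) = inj₂ (extend T y∈X e y∉ , extend-grows T y∈X e y∉)
  ... | no none = inj₁ λ {y} y∈X e → decidable-stable (y ∈? visited T) λ y∉ → none (y , y∈X , e , y∉)

  initial : ∀ {b} → b ∈ X → b ≢ a → Trail
  initial {b} b∈X b≢a with split-at-first-visit b≢a (conX b a b∈X a∈X)
  ... | t , w , e = record
    { visited     = ⁅ a ⁆
    ; end         = t
    ; visited⊆X   = x∈p⇒⁅x⁆⊆p a∈X
    ; end∈X       = x∈p-y⇒x∈p (walk-end w)
    ; end∉visited = λ t∈⁅a⁆ → x∈p-y⇒x≢y (walk-end w) (x∈⁅y⁆⇒x≡y a t∈⁅a⁆)
    ; reach       = stays-at-a
    ; linked      = t , a , x∈⁅x⁆ t , x∈⁅x⁆ a , e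
    }
    where
    stays-at-a : ∀ {z} → z ∈ ⁅ a ⁆ → WalkIn G ⁅ a ⁆ z a
    stays-at-a z∈⁅a⁆ rewrite x∈⁅y⁆⇒x≡y a z∈⁅a⁆ = stay (x∈⁅x⁆ a)

  -- A walk from x to end enters it from a neighbour, which maximality puts among the visited.
  maximal-end-non-cut : (T : Trail) → Maximal T → Connected G (X - end T)
  maximal-end-non-cut T maximal = hub⇒Connected toA
    where
    visited⊆X-end : visited T ⊆ X - end T
    visited⊆X-end z∈ = x∈p∧x≢y⇒x∈p-y (visited⊆X T z∈) λ { refl → end∉visited T z∈ }
    toA : ∀ x → x ∈ X - end T → WalkIn G (X - end T) x a
    toA x x∈ with split-at-first-visit (x∈p-y⇒x≢y x∈) (conX x (end T) (x∈p-y⇒x∈p x∈) (end∈X T))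
    ... | t , w , e =
      w ++ʷ walk-mono visited⊆X-end (reach T (maximal (x∈p-y⇒x∈p (walk-end w)) (Edge-sym e)))

  non-cut-vertex : ∀ {b} → b ∈ X → b ≢ a → ∃ λ u → u ∈ X × u ≢ a × Connected G (X - u)
  non-cut-vertex b∈X b≢a with descend (λ T → ∣ ∁ (visited T) ∣) maximal-or-extend (initial b∈X b≢a)
  ... | T , maximal =
    end T , end∈X T , (λ { refl → end∉visited T (a∈visited T) }) , maximal-end-non-cut T maximal

module Surgery {H G : Graph} (M : Model H G) {w : V H} {u : V G} (u∈Xw : u ∈ X M w)
               (rest-nonempty : Nonempty (X M w - u)) (rest-connected : Connected G (X M w - u)) where
  open GraphProperties G
  open GraphProperties H using () renaming (Edge-sym to Edgeᴴ-sym)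

  others-unchanged : ∀ {v} → w ≢ v → X M v - u ≡ X M v
  others-unchanged {v} w≢v = y∉p⇒p-y≡p (disjoint M w v w≢v u u∈Xw)

  nonempty-minus : ∀ v → Nonempty (X M v - u)
  nonempty-minus v with w ≟ v
  ... | yes refl = rest-nonempty
  ... | no w≢v rewrite others-unchanged w≢v = nonempty M v

  connected-minus : ∀ v → Connected G (X M v - u)
  connected-minus v with w ≟ v
  ... | yes refl = rest-connected
  ... | no w≢v rewrite others-unchanged w≢v = connected M v

  disjoint-minus : ∀ v v' → v ≢ v' → ∀ x → x ∈ X M v - u → x ∉ X M v' - u
  disjoint-minus v v' v≢v' x x∈ x∈' = disjoint M v v' v≢v' x (x∈p-y⇒x∈p x∈) (x∈p-y⇒x∈p x∈')

  Joined-minus⇒Edge : ∀ v v' → v ≢ v' → Joined G (X M v - u) (X M v' - u) → Edge H v v'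
  Joined-minus⇒Edge v v' v≢v' j = Equivalence.to (edges M v v' v≢v') (Joined-mono x∈p-y⇒x∈p x∈p-y⇒x∈p j)

  Edge⇒Joined-minus : (P : V H → Set) →
                      (∀ {v} → P v → w ≢ v → Edge H w v → Joined G (X M w - u) (X M v)) →
                      ∀ {v v'} → P v → P v' → v ≢ v' → Edge H v v' → Joined G (X M v - u) (X M v' - u)
  Edge⇒Joined-minus P join {v} {v'} Pv Pv' v≢v' e with w ≟ v | w ≟ v'
  ... | yes refl | yes refl = ⊥-elim (v≢v' refl)
  ... | yes refl | no w≢v' rewrite others-unchanged w≢v' = join Pv' v≢v' e
  ... | no w≢v | yes refl rewrite others-unchanged w≢v = Joined-sym (join Pv (≢-sym v≢v') (Edgeᴴ-sym e))
  ... | no w≢v | no w≢v' rewrite others-unchanged w≢v | others-unchanged w≢v' =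
    Equivalence.from (edges M v v' v≢v') e

  deleteVertex : (∀ {v} → w ≢ v → Edge H w v → Joined G (X M w - u) (X M v)) → Model H G
  deleteVertex join = record
    { X         = λ v → X M v - u
    ; nonempty  = nonempty-minus
    ; connected = connected-minus
    ; disjoint  = disjoint-minus
    ; edges     = λ v v' v≢v' → mk⇔ (Joined-minus⇒Edge v v' v≢v')
                                    (Edge⇒Joined-minus (λ _ → ⊤) (λ _ → join) tt tt v≢v')
    }

  module Transfer {c : V H} (universal : ∀ {v} → c ≢ v → Edge H c v)
                  (rest-to-u : Joined G (X M w - u) ⁅ u ⁆) (u-to-c : Joined G ⁅ u ⁆ (X M c)) where

    transferred : V H → Subset (n G)
    transferred v with v ≟ c
    ... | yes _ = X M c ∪ ⁅ u ⁆
    ... | no _  = X M v - u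

    transferred-⊆ : ∀ {v} → v ≢ c → transferred v ⊆ X M v - u
    transferred-⊆ {v} v≢c with v ≟ c
    ... | yes v≡c = ⊥-elim (v≢c v≡c)
    ... | no _    = id

    grown-disjoint : ∀ {v} → c ≢ v → ∀ x → x ∈ X M c ∪ ⁅ u ⁆ → x ∉ X M v - u
    grown-disjoint {v} c≢v x x∈ x∈' with x∈p∪q⁻ (X M c) ⁅ u ⁆ x∈
    ... | inj₁ x∈Xc  = disjoint M c v c≢v x x∈Xc (x∈p-y⇒x∈p x∈')
    ... | inj₂ x∈⁅u⁆ = x∈p-y⇒x≢y x∈' (x∈⁅y⁆⇒x≡y u x∈⁅u⁆)

    grown-joined : ∀ {v} → c ≢ v → Joined G (X M c ∪ ⁅ u ⁆) (X M v - u)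
    grown-joined {v} c≢v with w ≟ v
    ... | yes refl = Joined-mono (q⊆p∪q (X M c) ⁅ u ⁆) id (Joined-sym rest-to-u)
    ... | no w≢v rewrite others-unchanged w≢v =
      Joined-mono (p⊆p∪q ⁅ u ⁆) id (Equivalence.from (edges M c v c≢v) (universal c≢v))

    transferVertex : (∀ {v} → v ≢ c → w ≢ v → Edge H w v → Joined G (X M w - u) (X M v)) → Model H G
    transferVertex join = record
      { X         = transferred
      ; nonempty  = nonempty'
      ; connected = connected'
      ; disjoint  = disjoint'
      ; edges     = λ v v' v≢v' → mk⇔ (to v v' v≢v') (from v v' v≢v')
      }
      where
      nonempty' : ∀ v → Nonempty (transferred v)
      nonempty' v with v ≟ c
      ... | yes refl = proj₁ (nonempty M c) , p⊆p∪q ⁅ u ⁆ (proj₂ (nonempty M c))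
      ... | no _     = nonempty-minus v

      connected' : ∀ v → Connected G (transferred v)
      connected' v with v ≟ c
      ... | yes refl = Connected-∪⁅⁆ (connected M c) u-to-c
      ... | no _     = connected-minus v

      disjoint' : ∀ v v' → v ≢ v' → ∀ x → x ∈ transferred v → x ∉ transferred v'
      disjoint' v v' v≢v' x with v ≟ c | v' ≟ c
      ... | yes refl | yes refl = ⊥-elim (v≢v' refl)
      ... | yes refl | no _     = grown-disjoint v≢v' x
      ... | no _     | yes refl = λ x∈ x∈' → grown-disjoint (≢-sym v≢v') x x∈' x∈
      ... | no _     | no _     = disjoint-minus v v' v≢v' x

      to : ∀ v v' → v ≢ v' → Joined G (transferred v) (transferred v') → Edge H v v'
      to v v' v≢v' with v ≟ c | v' ≟ c
      ... | yes refl | yes refl = ⊥-elim (v≢v' refl)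
      ... | yes refl | no _     = λ _ → universal v≢v'
      ... | no _     | yes refl = λ _ → Edgeᴴ-sym (universal (≢-sym v≢v'))
      ... | no _     | no _     = Joined-minus⇒Edge v v' v≢v'

      from : ∀ v v' → v ≢ v' → Edge H v v' → Joined G (transferred v) (transferred v')
      from v v' v≢v' with v ≟ c | v' ≟ c
      ... | yes refl | yes refl = ⊥-elim (v≢v' refl)
      ... | yes refl | no _     = λ _ → grown-joined v≢v'
      ... | no _     | yes refl = λ _ → Joined-sym (grown-joined (≢-sym v≢v'))
      ... | no v≢c   | no v'≢c  = Edge⇒Joined-minus (_≢ c) join v≢c v'≢c v≢v'

module Covered {H G : Graph} {S : V H → Set} (S? : Decidable S) where

  covered? : (M : Model H G) → Decidable (λ x → ∃ λ v → ¬ S v × x ∈ X M v)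
  covered? M x = any? λ v → ¬? (S? v) ×-dec (x ∈? X M v)

  covered : Model H G → Subset (n G)
  covered M = toSubset (covered? M)

  covered-shrinks : (M M' : Model H G) {w : V H} {u : V G} → ¬ S w → u ∈ X M w →
                    (∀ {v} → ¬ S v → X M' v ⊆ X M v - u) → ∣ covered M' ∣ < ∣ covered M ∣
  covered-shrinks M M' {w} {u} ¬Sw u∈Xw shrinks =
    p⊂q⇒∣p∣<∣q∣ (covered⊆ , u , ∈-toSubset⁺ (covered? M) (w , ¬Sw , u∈Xw) , u∉covered)
    where
    covered⊆ : covered M' ⊆ covered M
    covered⊆ x∈ with ∈-toSubset⁻ (covered? M') x∈
    ... | v , ¬Sv , x∈Xv = ∈-toSubset⁺ (covered? M) (v , ¬Sv , x∈p-y⇒x∈p (shrinks ¬Sv x∈Xv))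
    u∉covered : u ∉ covered M'
    u∉covered u∈ with ∈-toSubset⁻ (covered? M') u∈
    ... | v , ¬Sv , u∈Xv = x∈p-y⇒x≢y (shrinks ¬Sv u∈Xv) refl

AllButOne : {A : Set} (Q P : A → Set) → Set
AllButOne Q P = ∀ {c c'} → Q c → Q c' → c ≢ c' → P c ⊎ P c'

AtMostThree : {A : Set} (Q : A → Set) → Set
AtMostThree {A} Q = (cs : Vec A 4) → All Q cs → ¬ Unique cs

bounded⇒¬Unique : ∀ {n m} (cs : Vec (Fin n) (suc m)) → All (λ c → toℕ c < m) cs → ¬ Unique cs
bounded⇒¬Unique {m = m} cs bounded unique = <-irrefl refl (injective⇒≤ f-injective)
  where
  f : Fin (suc m) → Fin m
  f i = fromℕ< (All.lookup bounded (∈-lookup i cs))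
  f-injective : Injective _≡_ _≡_ f
  f-injective {i} {j} fi≡fj =
    lookup-injective unique i j (toℕ-injective (fromℕ<-injective _ _ _ _ fi≡fj))

two-failures⇒AllButOne : {A : Set} {Q P₁ P₂ : A → Set} → DecidableEquality A → AtMostThree Q →
                         (∀ {c} → Q c → P₁ c ⊎ P₂ c) →
                         ∀ {c₁ c₂} → Q c₁ → Q c₂ → c₁ ≢ c₂ → ¬ P₁ c₁ → ¬ P₁ c₂ → AllButOne Q P₂
two-failures⇒AllButOne {Q = Q} {P₁} {P₂} _≟_ atMostThree cover {c₁} {c₂} Qc₁ Qc₂ c₁≢c₂ ¬P₁c₁ ¬P₁c₂
                       {c} {c'} Qc Qc' c≢c'
  with P₂-or-fresh Qc | P₂-or-fresh Qc'
  where
  P₂-at : ∀ {d} → Q d → ¬ P₁ d → P₂ d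
  P₂-at Qd ¬P₁d = [ ⊥-elim ∘ ¬P₁d , id ]′ (cover Qd)
  P₂-or-fresh : ∀ {d} → Q d → P₂ d ⊎ (d ≢ c₁ × d ≢ c₂)
  P₂-or-fresh {d} Qd with d ≟ c₁ | d ≟ c₂
  ... | yes refl | _        = inj₁ (P₂-at Qd ¬P₁c₁)
  ... | no _     | yes refl = inj₁ (P₂-at Qd ¬P₁c₂)
  ... | no d≢c₁  | no d≢c₂  = inj₂ (d≢c₁ , d≢c₂)
... | inj₁ P₂c | _         = inj₁ P₂c
... | inj₂ _   | inj₁ P₂c' = inj₂ P₂c'
... | inj₂ (c≢c₁ , c≢c₂) | inj₂ (c'≢c₁ , c'≢c₂) = ⊥-elim (atMostThree (c ∷ c' ∷ c₁ ∷ c₂ ∷ [])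
      (Qc ∷ Qc' ∷ Qc₁ ∷ Qc₂ ∷ [])
      ((c≢c' ∷ c≢c₁ ∷ c≢c₂ ∷ []) ∷ (c'≢c₁ ∷ c'≢c₂ ∷ []) ∷ (c₁≢c₂ ∷ []) ∷ [] ∷ []))

majority : ∀ {m} {Q P₁ P₂ : Fin m → Set} → Decidable Q → Decidable P₁ → AtMostThree Q →
           (∀ {c} → Q c → P₁ c ⊎ P₂ c) → AllButOne Q P₁ ⊎ AllButOne Q P₂
majority Q? P₁? atMostThree cover
  with any? (λ c₁ → any? (λ c₂ →
         Q? c₁ ×-dec Q? c₂ ×-dec ¬? (c₁ ≟ c₂) ×-dec ¬? (P₁? c₁) ×-dec ¬? (P₁? c₂)))
... | yes (c₁ , c₂ , Qc₁ , Qc₂ , c₁≢c₂ , ¬P₁c₁ , ¬P₁c₂) =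
  inj₂ (two-failures⇒AllButOne _≟_ atMostThree cover Qc₁ Qc₂ c₁≢c₂ ¬P₁c₁ ¬P₁c₂)
... | no noTwoFailures = inj₁ λ {c} {c'} Qc Qc' c≢c' → decidable-stable (P₁? c ⊎-dec P₁? c')
        λ ¬P₁ → noTwoFailures (c , c' , Qc , Qc' , c≢c' , ¬P₁ ∘ inj₁ , ¬P₁ ∘ inj₂)

module SplitGraphProperties (k p : ℕ) where

  Clique? : Decidable (Clique k p)
  Clique? c = toℕ c <? k

  clique-universal : ∀ {c v} → Clique k p c → c ≢ v → Edge (SplitGraph k p) c v
  clique-universal Kc c≢v = Equivalence.to T-≡
    (Equivalence.from T-∧ (fromWitnessFalse c≢v , Equivalence.from T-∨ (inj₁ (<⇒<ᵇ Kc))))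

  nonclique-neighbour : ∀ {w v} → ¬ Clique k p w → Edge (SplitGraph k p) w v → Clique k p v
  nonclique-neighbour {w} {v} ¬Kw e
    with Equivalence.to T-∨ (proj₂ (Equivalence.to T-∧ (Equivalence.from T-≡ e)))
  ... | inj₁ w<ᵇk = ⊥-elim (¬Kw (<ᵇ⇒< (toℕ w) k w<ᵇk))
  ... | inj₂ v<ᵇk = <ᵇ⇒< (toℕ v) k v<ᵇk

  clique-at-most-three : k ≤ 3 → AtMostThree (Clique k p)
  clique-at-most-three k≤3 cs Kcs = bounded⇒¬Unique cs (All.map (λ Kc → ≤-trans Kc k≤3) Kcs)

module Reduction {k p : ℕ} (k≤3 : k ≤ 3) {G : Graph} where
  open SplitGraphProperties k p
  open GraphProperties G
  open Covered {SplitGraph k p} {G} Clique?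

  measure : Model (SplitGraph k p) G → ℕ
  measure M = ∣ covered M ∣

  Smaller : Model (SplitGraph k p) G → Set
  Smaller M = ∃ λ M' → measure M' < measure M

  module _ (M : Model (SplitGraph k p) G) {w : V (SplitGraph k p)} (¬Kw : ¬ Clique k p w) where

    JoinedWithout : V G → V (SplitGraph k p) → Set
    JoinedWithout u c = Joined G (X M w - u) (X M c)

    joins-clique : ∀ {c} → Clique k p c → Joined G (X M w) (X M c)
    joins-clique {c} Kc = Joined-sym (Equivalence.from (edges M c w c≢w) (clique-universal Kc c≢w))
      where
      c≢w : c ≢ w
      c≢w refl = ¬Kw Kc

    module _ {u : V G} (u∈Xw : u ∈ X M w)
             (rest-nonempty : Nonempty (X M w - u)) (rest-connected : Connected G (X M w - u)) where
      open Surgery M u∈Xw rest-nonempty rest-connected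

      shrink : AllButOne (Clique k p) (JoinedWithout u) → Smaller M
      shrink good with any? (λ c → Clique? c ×-dec ¬? (Joined? (X M w - u) (X M c)))
      ... | no allJoined = deleteVertex join , covered-shrinks M (deleteVertex join) ¬Kw u∈Xw (λ _ → id)
        where
        join : ∀ {v} → w ≢ v → Edge (SplitGraph k p) w v → JoinedWithout u v
        join {v} _ e =
          decidable-stable (Joined? _ _) λ ¬J → allJoined (v , nonclique-neighbour ¬Kw e , ¬J)
      ... | yes (c₀ , Kc₀ , ¬J₀) =
        transferVertex join ,
        covered-shrinks M (transferVertex join) ¬Kw u∈Xw λ ¬Kv → transferred-⊆ λ { refl → ¬Kv Kc₀ }
        where
        u-to-c₀ : Joined G ⁅ u ⁆ (X M c₀)
        u-to-c₀ = [ ⊥-elim ∘ ¬J₀ , id ]′ (Joined-minus⊎Joined-⁅⁆ u (joins-clique Kc₀))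
        open Transfer (clique-universal Kc₀)
                      (Connected⇒Joined-minus-⁅⁆ (connected M w) u∈Xw rest-nonempty) u-to-c₀
        join : ∀ {v} → v ≢ c₀ → w ≢ v → Edge (SplitGraph k p) w v → JoinedWithout u v
        join v≢c₀ _ e = [ ⊥-elim ∘ ¬J₀ , id ]′ (good Kc₀ (nonclique-neighbour ¬Kw e) (≢-sym v≢c₀))

    reduce : ∀ {x y} → x ∈ X M w → y ∈ X M w → y ≢ x → Smaller M
    reduce {x} x∈ y∈ y≢x with NonCutVertex.non-cut-vertex G (connected M w) x∈ y∈ y≢x
    ... | u₁ , u₁∈ , u₁≢x , con₁ with NonCutVertex.non-cut-vertex G (connected M w) u₁∈ x∈ (≢-sym u₁≢x)
    ... | u₂ , u₂∈ , u₂≢u₁ , con₂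
      with majority Clique? (λ c → Joined? (X M w - u₁) (X M c)) (clique-at-most-three k≤3)
             (Joined-minus-either u₁∈ (≢-sym u₂≢u₁) ∘ joins-clique)
    ... | inj₁ good₁ = shrink u₁∈ (x , x∈p∧x≢y⇒x∈p-y x∈ (≢-sym u₁≢x)) con₁ good₁
    ... | inj₂ good₂ = shrink u₂∈ (u₁ , x∈p∧x≢y⇒x∈p-y u₁∈ (≢-sym u₂≢u₁)) con₂ good₂

  reduce-or-done : (M : Model (SplitGraph k p) G) → (∀ w → ¬ Clique k p w → ∣ X M w ∣ ≡ 1) ⊎ Smaller M
  reduce-or-done M with any? (λ w → ¬? (Clique? w) ×-dec ¬? (∣ X M w ∣ ℕ.≟ 1))
  ... | no none = inj₁ λ w ¬Kw → decidable-stable (∣ X M w ∣ ℕ.≟ 1) λ ∣Xw∣≢1 → none (w , ¬Kw , ∣Xw∣≢1)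
  ... | yes (w , ¬Kw , ∣Xw∣≢1) with ∣p∣≢1⇒two-elements (nonempty M w) ∣Xw∣≢1
  ...   | x , y , x∈ , y∈ , x≢y = inj₂ (reduce M ¬Kw y∈ x∈ x≢y)

lemma3p11 : (k p : ℕ) → k ≤ 3 → NonTrivial (SplitGraph k p) (Clique k p)
lemma3p11 k p k≤3 G = descend measure reduce-or-done
  where open Reduction {k} {p} k≤3 {G}
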